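{- Let $V=\mathbb{G}_m^N$ over $\mathbb{Q}$, with archimedean height $H_{V,\mathbb{R}}$ and finite height $H_{V,f}$ associated to a closed affine embedding of $V$ defined over $\mathbb{Q}$. Then $H_{V,\mathbb{R}}\preccurlyeq H_{V,f}$ on $(\mathbb{Q}^\times)^N$.
   Context: For a closed affine embedding $V\to\mathbb{A}^M$ over $\mathbb{Q}$, $H_{V,\mathbb{R}}(w)=\max\{1,|w_1|,\dots,|w_M|\}$ (real absolute value) and $H_{V,f}(w)=\prod_p\max\{1,|w_1|_p,\dots,|w_M|_p\}$. For $f,g\ge0$ on a set, $g\preccurlyeq f$ means $g\le c+af^b$ for constants $a,b,c\ge0$. -}

module Defs where

open import Data.Nat as ℕ using (ℕ; zero; suc)
open import Data.Nat.Properties using (m^n≢0)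
open import Data.Nat.Divisibility using (_∣?_)
open import Data.Nat.Primality using (prime?)
open import Data.Integer as ℤ using (ℤ; +_; -[1+_])
open import Data.Rational as ℚ using (ℚ; 0ℚ; 1ℚ; _+_; _*_; _⊔_; ∣_∣; _/_; ↥_; ↧ₙ_)
open import Data.Fin using (Fin)
open import Data.Vec using (Vec; []; _∷_; lookup)
open import Data.List using (List; []; _∷_; foldr; map; upTo)
open import Data.Product using (_×_; _,_; proj₁; proj₂)
open import Relation.Nullary using (yes; no)
open import Relation.Nullary.Decidable using (does)
open import Data.Bool using (if_then_else_)
open import Relation.Binary.PropositionalEquality using (_≡_)

_^ℚ_ : ℚ → ℕ → ℚ
q ^ℚ zero  = 1ℚ
q ^ℚ suc n = q * (q ^ℚ n)

-- A ℚ-point of G_m^N : coordinates x i together with their inverses y i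
-- (the standard affine presentation G_m = Spec ℚ[x,y]/(xy-1)).
record TorusPoint (N : ℕ) : Set where
  field
    x    : Fin N → ℚ
    y    : Fin N → ℚ
    inv  : ∀ i → x i * y i ≡ 1ℚ
open TorusPoint public

-- Laurent polynomials in N variables over ℚ (= regular functions on G_m^N):
-- finite lists of (coefficient, exponent vector in ℤ^N).
LaurentPoly : ℕ → Set
LaurentPoly N = List (ℚ × Vec ℤ N)

powℤ : ∀ {N} → TorusPoint N → Fin N → ℤ → ℚ
powℤ P i (+ n)     = x P i ^ℚ n
powℤ P i -[1+ n ]  = y P i ^ℚ suc n

evalMonoℤ : ∀ {N} → TorusPoint N → (Fin N → ℤ → ℚ) → ∀ {k} → Vec ℤ k → (Fin k → Fin N) → ℚ
evalMonoℤ P f [] ι = 1ℚ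
evalMonoℤ P f (e ∷ es) ι = f (ι Fin.zero) e * evalMonoℤ P f es (λ j → ι (Fin.suc j))
  where import Data.Fin as Fin

evalLaurent : ∀ {N} → LaurentPoly N → TorusPoint N → ℚ
evalLaurent g P = foldr (λ t acc → proj₁ t * evalMonoℤ P (powℤ P) (proj₂ t) (λ i → i) + acc) 0ℚ g

Poly : ℕ → Set
Poly M = List (ℚ × Vec ℕ M)

evalMonoℕ : ∀ {k M} → (Fin M → ℚ) → Vec ℕ k → (Fin k → Fin M) → ℚ
evalMonoℕ w [] ι = 1ℚ
evalMonoℕ w (e ∷ es) ι = (w (ι Fin.zero) ^ℚ e) * evalMonoℕ w es (λ j → ι (Fin.suc j))
  where import Data.Fin as Fin

evalPoly : ∀ {M} → Poly M → (Fin M → ℚ) → ℚ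
evalPoly p w = foldr (λ t acc → proj₁ t * evalMonoℕ w (proj₂ t) (λ i → i) + acc) 0ℚ p

-- A morphism φ : G_m^N → A^M over ℚ is given by M Laurent polynomials.
Morphism : ℕ → ℕ → Set
Morphism N M = Fin M → LaurentPoly N

apply : ∀ {N M} → Morphism N M → TorusPoint N → Fin M → ℚ
apply φ P j = evalLaurent (φ j) P

-- φ is a closed embedding iff the pull-back ℚ[y_1..y_M] → ℚ[x^{±1}] is
-- surjective: every Laurent polynomial g equals P ∘ φ for some polynomial P.
-- (Equality in ℚ[x^{±1}] is tested on ℚ-points of G_m^N, which is
-- equivalent since ℚ is infinite.)
IsClosedEmbedding : ∀ {N M} → Morphism N M → Set
IsClosedEmbedding {N} {M} φ =
  ∀ (g : LaurentPoly N) → Data.Product.∃ λ (p : Poly M) →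
    ∀ (P : TorusPoint N) → evalPoly p (apply φ P) ≡ evalLaurent g P
  where import Data.Product

maxOver : ∀ {M} → (Fin M → ℚ) → ℚ
maxOver {M} f = foldr (λ i acc → f i ⊔ acc) 1ℚ (Data.List.allFin M)
  where import Data.List

H-R : ∀ {M} → (Fin M → ℚ) → ℚ
H-R w = maxOver (λ j → ∣ w j ∣)

-- p-adic valuation of a natural number (fuel-bounded; fuel n suffices for p ≥ 2);
-- argument p is given as suc q.
valAux : ℕ → ℕ → ℕ → ℕ
valAux q zero n = 0
valAux q (suc fuel) zero = 0
valAux q (suc fuel) (suc n) with suc q ∣? suc n
... | yes _ = suc (valAux q fuel (ℕ._/_ (suc n) (suc q)))
... | no  _ = 0

val : (q : ℕ) → ℕ → ℕ
val q n = valAux q n n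

abs-p : ℕ → ℚ → ℚ
abs-p q w with ↥ w
... | + zero = 0ℚ
... | n = _/_ (+ (suc q ℕ.^ val q (↧ₙ w))) (suc q ℕ.^ val q (ℤ.∣ n ∣))
            {{m^n≢0 (suc q) (val q (ℤ.∣ n ∣))}}

localFactor : ∀ {M} → ℕ → (Fin M → ℚ) → ℚ
localFactor q w = maxOver (λ j → abs-p q (w j))

-- product of denominators: every prime p with a nontrivial local factor is ≤ this
denomBound : ∀ {M} → (Fin M → ℚ) → ℕ
denomBound {M} w = foldr (λ j acc → ↧ₙ (w j) ℕ.* acc) 1 (Data.List.allFin M)
  where import Data.List

-- H_f(w) = ∏_p max{1, |w_1|_p, ..., |w_M|_p}; the factor is 1 for all primes
-- p > denomBound w, so the product is taken over primes p ≤ denomBound w.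
H-f : ∀ {M} → (Fin M → ℚ) → ℚ
H-f w = foldr (λ q acc → (if does (prime? (suc q)) then localFactor q w else 1ℚ) * acc)
              1ℚ (upTo (denomBound w))

-- Write w = φ(P). Each coordinate w_j is a Laurent polynomial in the torus coordinates, and
-- for every monomial x^e its inverse x^(-e) is, φ being a closed embedding, a polynomial in w.
-- If L is a common denominator of the w_j, that polynomial value has denominator dividing
-- D L^d for constants D, d, so it is a nonzero integer divided by D L^d and its inverse x^e(P)
-- has absolute value at most D L^d. Hence |w_j| ≤ C L^E uniformly in P. Taking for L the
-- product of the denominators of the w_j, and noting that each denominator is the product of
-- its p-parts, each of which is read off from |w_j|_p, gives L ≤ H_f(w)^M, and therefore
-- H_R(w) ≤ 1 + C H_f(w)^(M E).

module Submission where

open import Defs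

open import Algebra.Bundles using (CommutativeMonoid)
open import Data.Bool using (if_then_else_)
open import Data.Empty using (⊥; ⊥-elim)
open import Data.Fin as Fin using (Fin)
open import Data.Integer as ℤ using (ℤ; +_; -[1+_])
import Data.Integer.Properties as ℤP
open import Data.List using (List; []; _∷_; foldr; map; allFin; upTo; length)
open import Data.List.Membership.Propositional using (_∈_)
open import Data.List.Membership.Propositional.Properties using (∈-allFin; ∈-upTo⁺)
open import Data.List.Properties using (length-tabulate)
open import Data.List.Relation.Unary.All using (All; []; _∷_)
open import Data.List.Relation.Unary.Any using (here; there)
open import Data.Nat as ℕ using (ℕ; zero; suc; z≤n; s≤s)
open import Data.Nat.Coprimality as Coprimality using (Coprime; recompute)
open import Data.Nat.DivMod using (m/n<m; *-/-assoc; m*n/n≡m)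
open import Data.Nat.Divisibility
  using (_∣_; _∣?_; _∣0; divides; *-pres-∣; m∣m*n; n∣m*n; ∣n⇒∣m*n; ∣⇒≤)
open import Data.Nat.ListAction using (sum; product)
open import Data.Nat.Primality using (Prime; prime?; ¬prime[0]; ¬prime[1]; productOfPrimes≥1)
open import Data.Nat.Primality.Factorisation using (factorise; PrimeFactorisation)
import Data.Nat.Properties as ℕP
open import Data.Product using (∃; _×_; _,_; proj₁; proj₂)
open import Data.Rational as ℚ using (ℚ; mkℚ; 0ℚ; 1ℚ; _+_; _*_; ∣_∣; _/_; ↥_; ↧ₙ_; _≤_; *≤*)
import Data.Rational.Properties as ℚP
import Data.Rational.Unnormalised as ℚᵘ
import Data.Rational.Unnormalised.Properties as ℚᵘP
open import Data.Vec using (Vec; []; _∷_)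
import Data.Vec as Vec
open import Function using (_∘_)
open import Relation.Binary.PropositionalEquality
open import Relation.Nullary using (Dec; yes; no; ¬_)
open import Relation.Nullary.Decidable using (does)

open import Algebra.Properties.CommutativeSemigroup
  (CommutativeMonoid.commutativeSemigroup ℚP.*-1-commutativeMonoid)
  using () renaming (interchange to *-interchange)
open import Algebra.Properties.CommutativeSemigroup ℕP.*-commutativeSemigroup
  using (x∙yz≈y∙xz)

fromℤ : ℤ → ℚ
fromℤ z = mkℚ z 0 (Coprimality.sym (Coprimality.1-coprimeTo _))

fromℕ : ℕ → ℚ
fromℕ n = fromℤ (+ n)

z/1≡fromℤ : ∀ z → z / 1 ≡ fromℤ z
z/1≡fromℤ z = ℚP.↥p/↧p≡p (fromℤ z)

fromℤ-+ : ∀ a b → fromℤ a + fromℤ b ≡ fromℤ (a ℤ.+ b)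
fromℤ-+ a b =
  trans (cong (_/ 1) (cong₂ ℤ._+_ (ℤP.*-identityʳ a) (ℤP.*-identityʳ b))) (z/1≡fromℤ _)

fromℤ-* : ∀ a b → fromℤ a * fromℤ b ≡ fromℤ (a ℤ.* b)
fromℤ-* a b = z/1≡fromℤ _

fromℕ-* : ∀ m n → fromℕ (m ℕ.* n) ≡ fromℕ m * fromℕ n
fromℕ-* m n = trans (cong fromℤ (ℤP.pos-* m n)) (sym (fromℤ-* (+ m) (+ n)))

fromℕ-^ : ∀ m n → fromℕ (m ℕ.^ n) ≡ fromℕ m ^ℚ n
fromℕ-^ m zero    = refl
fromℕ-^ m (suc n) = trans (fromℕ-* m (m ℕ.^ n)) (cong (fromℕ m *_) (fromℕ-^ m n))

fromℕ-mono-≤ : ∀ {m n} → m ℕ.≤ n → fromℕ m ≤ fromℕ n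
fromℕ-mono-≤ {m} {n} m≤n =
  *≤* (subst₂ ℤ._≤_ (sym (ℤP.*-identityʳ (+ m))) (sym (ℤP.*-identityʳ (+ n))) (ℤ.+≤+ m≤n))

0≤fromℕ : ∀ n → 0ℚ ≤ fromℕ n
0≤fromℕ n = fromℕ-mono-≤ z≤n

0≤1 : 0ℚ ≤ 1ℚ
0≤1 = 0≤fromℕ 1

*-mono-≤-nonNeg : ∀ {p q r s} → 0ℚ ≤ p → 0ℚ ≤ s → p ≤ q → r ≤ s → p * r ≤ q * s
*-mono-≤-nonNeg {p} {q} {r} {s} 0≤p 0≤s p≤q r≤s =
  ℚP.≤-trans (ℚP.*-monoˡ-≤-nonNeg p {{ℚ.nonNegative 0≤p}} r≤s)
             (ℚP.*-monoʳ-≤-nonNeg s {{ℚ.nonNegative 0≤s}} p≤q)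

0≤p*q : ∀ {p q} → 0ℚ ≤ p → 0ℚ ≤ q → 0ℚ ≤ p * q
0≤p*q 0≤p 0≤q = *-mono-≤-nonNeg ℚP.≤-refl 0≤q 0≤p 0≤q

1≤p*q : ∀ {p q} → 1ℚ ≤ p → 1ℚ ≤ q → 1ℚ ≤ p * q
1≤p*q 1≤p 1≤q = *-mono-≤-nonNeg 0≤1 (ℚP.≤-trans 0≤1 1≤q) 1≤p 1≤q

p≤p+q : ∀ {p q} → 0ℚ ≤ q → p ≤ p + q
p≤p+q {p} 0≤q = ℚP.≤-trans (ℚP.≤-reflexive (sym (ℚP.+-identityʳ p))) (ℚP.+-monoʳ-≤ p 0≤q)

q≤p+q : ∀ {p q} → 0ℚ ≤ p → q ≤ p + q
q≤p+q {p} {q} 0≤p = ℚP.≤-trans (ℚP.≤-reflexive (sym (ℚP.+-identityˡ q))) (ℚP.+-monoˡ-≤ q 0≤p)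

0≤p^n : ∀ {p} n → 0ℚ ≤ p → 0ℚ ≤ p ^ℚ n
0≤p^n zero    _   = 0≤1
0≤p^n (suc n) 0≤p = 0≤p*q 0≤p (0≤p^n n 0≤p)

1≤p^n : ∀ {p} n → 1ℚ ≤ p → 1ℚ ≤ p ^ℚ n
1≤p^n zero    _   = ℚP.≤-refl
1≤p^n (suc n) 1≤p = 1≤p*q 1≤p (1≤p^n n 1≤p)

^ℚ-monoˡ-≤ : ∀ {p q} n → 0ℚ ≤ p → p ≤ q → p ^ℚ n ≤ q ^ℚ n
^ℚ-monoˡ-≤ zero    _   _   = ℚP.≤-refl
^ℚ-monoˡ-≤ (suc n) 0≤p p≤q =
  *-mono-≤-nonNeg 0≤p (0≤p^n n (ℚP.≤-trans 0≤p p≤q)) p≤q (^ℚ-monoˡ-≤ n 0≤p p≤q)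

^ℚ-monoʳ-≤ : ∀ {p m n} → 1ℚ ≤ p → m ℕ.≤ n → p ^ℚ m ≤ p ^ℚ n
^ℚ-monoʳ-≤ {n = n} 1≤p z≤n = 1≤p^n n 1≤p
^ℚ-monoʳ-≤ {p} 1≤p (s≤s m≤n) =
  ℚP.*-monoˡ-≤-nonNeg p {{ℚ.nonNegative (ℚP.≤-trans 0≤1 1≤p)}} (^ℚ-monoʳ-≤ 1≤p m≤n)

^ℚ-+ : ∀ p m n → p ^ℚ (m ℕ.+ n) ≡ p ^ℚ m * p ^ℚ n
^ℚ-+ p zero    n = sym (ℚP.*-identityˡ _)
^ℚ-+ p (suc m) n = trans (cong (p *_) (^ℚ-+ p m n)) (sym (ℚP.*-assoc p _ _))

^ℚ-* : ∀ p m n → p ^ℚ (m ℕ.* n) ≡ (p ^ℚ m) ^ℚ n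
^ℚ-* p m zero    = cong (p ^ℚ_) (ℕP.*-zeroʳ m)
^ℚ-* p m (suc n) = begin
  p ^ℚ (m ℕ.* suc n)        ≡⟨ cong (p ^ℚ_) (ℕP.*-suc m n) ⟩
  p ^ℚ (m ℕ.+ m ℕ.* n)      ≡⟨ ^ℚ-+ p m (m ℕ.* n) ⟩
  p ^ℚ m * p ^ℚ (m ℕ.* n)   ≡⟨ cong (p ^ℚ m *_) (^ℚ-* p m n) ⟩
  (p ^ℚ m) ^ℚ suc n         ∎
  where open ≡-Reasoning

^ℚ-inverse : ∀ p q → p * q ≡ 1ℚ → ∀ n → p ^ℚ n * q ^ℚ n ≡ 1ℚ
^ℚ-inverse p q pq≡1 zero    = refl
^ℚ-inverse p q pq≡1 (suc n) = begin
  p * p ^ℚ n * (q * q ^ℚ n)   ≡⟨ *-interchange p (p ^ℚ n) q (q ^ℚ n) ⟩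
  p * q * (p ^ℚ n * q ^ℚ n)   ≡⟨ cong₂ _*_ pq≡1 (^ℚ-inverse p q pq≡1 n) ⟩
  1ℚ                          ∎
  where open ≡-Reasoning

-- Clearing denominators

record Clears (K : ℕ) (p : ℚ) : Set where
  constructor cleared
  field
    integer   : ℤ
    *-cleared : p * fromℕ K ≡ fromℤ integer

clears-0 : ∀ {K} → Clears K 0ℚ
clears-0 {K} = cleared (+ 0) (ℚP.*-zeroˡ (fromℕ K))

clears-1 : Clears 1 1ℚ
clears-1 = cleared (+ 1) refl

clears-↧ : ∀ p → Clears (↧ₙ p) p
clears-↧ p@(mkℚ n d _) = cleared n (ℚP.toℚᵘ-injective (begin
  ℚ.toℚᵘ (p * fromℕ (suc d))               ≈⟨ ℚP.toℚᵘ-homo-* p (fromℕ (suc d)) ⟩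
  ℚ.toℚᵘ p ℚᵘ.* ℚ.toℚᵘ (fromℕ (suc d))    ≈⟨ ℚᵘ.*≡* (trans (ℤP.*-identityʳ _)
                                                (cong (n ℤ.*_) (cong +_ (sym (ℕP.*-identityʳ (suc d)))))) ⟩
  ℚ.toℚᵘ (fromℤ n)                         ∎))
  where open ℚᵘP.≃-Reasoning

clears-+ : ∀ {K p q} → Clears K p → Clears K q → Clears K (p + q)
clears-+ {K} {p} {q} (cleared z pK≡z) (cleared z′ qK≡z′) = cleared (z ℤ.+ z′) (begin
  (p + q) * fromℕ K              ≡⟨ ℚP.*-distribʳ-+ (fromℕ K) p q ⟩
  p * fromℕ K + q * fromℕ K      ≡⟨ cong₂ _+_ pK≡z qK≡z′ ⟩
  fromℤ z + fromℤ z′             ≡⟨ fromℤ-+ z z′ ⟩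
  fromℤ (z ℤ.+ z′)               ∎)
  where open ≡-Reasoning

clears-* : ∀ {K L p q} → Clears K p → Clears L q → Clears (K ℕ.* L) (p * q)
clears-* {K} {L} {p} {q} (cleared z pK≡z) (cleared z′ qL≡z′) = cleared (z ℤ.* z′) (begin
  p * q * fromℕ (K ℕ.* L)        ≡⟨ cong (p * q *_) (fromℕ-* K L) ⟩
  p * q * (fromℕ K * fromℕ L)    ≡⟨ *-interchange p q (fromℕ K) (fromℕ L) ⟩
  p * fromℕ K * (q * fromℕ L)    ≡⟨ cong₂ _*_ pK≡z qL≡z′ ⟩
  fromℤ z * fromℤ z′             ≡⟨ fromℤ-* z z′ ⟩
  fromℤ (z ℤ.* z′)               ∎)
  where open ≡-Reasoning

clears-^ : ∀ {K p} n → Clears K p → Clears (K ℕ.^ n) (p ^ℚ n)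
clears-^ zero    _  = clears-1
clears-^ (suc n) cp = clears-* cp (clears-^ n cp)

clears-∣ : ∀ {K K′ p} → K ∣ K′ → Clears K p → Clears K′ p
clears-∣ {K} {p = p} (divides m refl) (cleared z pK≡z) = cleared (z ℤ.* + m) (begin
  p * fromℕ (m ℕ.* K)       ≡⟨ cong (p *_) (trans (fromℕ-* m K) (ℚP.*-comm (fromℕ m) (fromℕ K))) ⟩
  p * (fromℕ K * fromℕ m)   ≡⟨ ℚP.*-assoc p (fromℕ K) (fromℕ m) ⟨
  p * fromℕ K * fromℕ m     ≡⟨ cong (_* fromℕ m) pK≡z ⟩
  fromℤ z * fromℕ m         ≡⟨ fromℤ-* z (+ m) ⟩
  fromℤ (z ℤ.* + m)         ∎)
  where open ≡-Reasoning

1≤∣fromℤ∣ : ∀ {z} → z ≢ + 0 → 1ℚ ≤ ∣ fromℤ z ∣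
1≤∣fromℤ∣ {+ zero}    z≢0 = ⊥-elim (z≢0 refl)
1≤∣fromℤ∣ {+ suc n}   _   = fromℕ-mono-≤ (s≤s z≤n)
1≤∣fromℤ∣ { -[1+ n ]} _   = fromℕ-mono-≤ (s≤s z≤n)

clears-inverse⇒∣p∣≤ : ∀ {p q K} .{{_ : ℕ.NonZero K}} →
  p * q ≡ 1ℚ → Clears K q → ∣ p ∣ ≤ fromℕ K
clears-inverse⇒∣p∣≤ {p} {q} {K} pq≡1 (cleared z qK≡z) = begin
  ∣ p ∣                 ≡⟨ ℚP.*-identityʳ ∣ p ∣ ⟨
  ∣ p ∣ * 1ℚ            ≤⟨ ℚP.*-monoˡ-≤-nonNeg ∣ p ∣ {{ℚP.∣-∣-nonNeg p}} (1≤∣fromℤ∣ z≢0) ⟩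
  ∣ p ∣ * ∣ fromℤ z ∣   ≡⟨ ℚP.∣p*q∣≡∣p∣*∣q∣ p (fromℤ z) ⟨
  ∣ p * fromℤ z ∣       ≡⟨ cong ∣_∣ pz≡K ⟩
  fromℕ K               ∎
  where
  open ℚP.≤-Reasoning
  pz≡K : p * fromℤ z ≡ fromℕ K
  pz≡K = begin-equality
    p * fromℤ z          ≡⟨ cong (p *_) qK≡z ⟨
    p * (q * fromℕ K)    ≡⟨ ℚP.*-assoc p q (fromℕ K) ⟨
    p * q * fromℕ K      ≡⟨ cong (_* fromℕ K) pq≡1 ⟩
    1ℚ * fromℕ K         ≡⟨ ℚP.*-identityˡ (fromℕ K) ⟩
    fromℕ K              ∎
  z≢0 : z ≢ + 0
  z≢0 z≡0 = ℕ.≢-nonZero⁻¹ K (ℤP.+-injective (cong ↥_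
    (trans (sym pz≡K) (trans (cong (λ z → p * fromℤ z) z≡0) (ℚP.*-zeroʳ p)))))

coeffDenominator : ∀ {M} → Poly M → ℕ
coeffDenominator p = product (map (↧ₙ_ ∘ proj₁) p)

degreeSum : ∀ {M} → Poly M → ℕ
degreeSum p = sum (map (Vec.sum ∘ proj₂) p)

coeffDenominator≢0 : ∀ {M} (p : Poly M) → ℕ.NonZero (coeffDenominator p)
coeffDenominator≢0 []            = _
coeffDenominator≢0 ((c , _) ∷ p) =
  ℕP.m*n≢0 (↧ₙ c) (coeffDenominator p) {{_}} {{coeffDenominator≢0 p}}

m^n∣m^[n+o] : ∀ m n o → m ℕ.^ n ∣ m ℕ.^ (n ℕ.+ o)
m^n∣m^[n+o] m n o = subst (m ℕ.^ n ∣_) (sym (ℕP.^-distribˡ-+-* m n o)) (m∣m*n (m ℕ.^ o))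

m^o∣m^[n+o] : ∀ m n o → m ℕ.^ o ∣ m ℕ.^ (n ℕ.+ o)
m^o∣m^[n+o] m n o = subst (m ℕ.^ o ∣_) (sym (ℕP.^-distribˡ-+-* m n o)) (n∣m*n (m ℕ.^ n))

clears-evalMonoℕ : ∀ {M L} (w : Fin M → ℚ) → (∀ j → Clears L (w j)) →
  ∀ {k} (es : Vec ℕ k) (ι : Fin k → Fin M) → Clears (L ℕ.^ Vec.sum es) (evalMonoℕ w es ι)
clears-evalMonoℕ         w cw []       ι = clears-1
clears-evalMonoℕ {L = L} w cw (e ∷ es) ι =
  subst (λ K → Clears K _) (sym (ℕP.^-distribˡ-+-* L e (Vec.sum es)))
    (clears-* (clears-^ e (cw (ι Fin.zero))) (clears-evalMonoℕ w cw es (ι ∘ Fin.suc)))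

clears-evalPoly : ∀ {M L} (p : Poly M) (w : Fin M → ℚ) → (∀ j → Clears L (w j)) →
  Clears (coeffDenominator p ℕ.* L ℕ.^ degreeSum p) (evalPoly p w)
clears-evalPoly                []             w cw = clears-0
clears-evalPoly {L = L} ((c , es) ∷ p) w cw = clears-+
  (clears-∣ (*-pres-∣ (m∣m*n {↧ₙ c} D) (m^n∣m^[n+o] L d e)) clears-term)
  (clears-∣ (*-pres-∣ (n∣m*n (↧ₙ c) {D}) (m^o∣m^[n+o] L d e)) (clears-evalPoly p w cw))
  where
  D = coeffDenominator p
  d = Vec.sum es
  e = degreeSum p
  clears-term : Clears (↧ₙ c ℕ.* L ℕ.^ d) (c * evalMonoℕ w es (λ i → i))
  clears-term = clears-* (clears-↧ c) (clears-evalMonoℕ w cw es (λ i → i))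

powℤ-inverse : ∀ {N} (P : TorusPoint N) i e → powℤ P i e * powℤ P i (ℤ.- e) ≡ 1ℚ
powℤ-inverse P i (+ zero)  = refl
powℤ-inverse P i (+ suc n) = ^ℚ-inverse (x P i) (y P i) (inv P i) (suc n)
powℤ-inverse P i -[1+ n ]  =
  trans (ℚP.*-comm (y P i ^ℚ suc n) (x P i ^ℚ suc n)) (^ℚ-inverse (x P i) (y P i) (inv P i) (suc n))

evalMonoℤ-inverse : ∀ {N} (P : TorusPoint N) {k} (es : Vec ℤ k) (ι : Fin k → Fin N) →
  evalMonoℤ P (powℤ P) es ι * evalMonoℤ P (powℤ P) (Vec.map ℤ.-_ es) ι ≡ 1ℚ
evalMonoℤ-inverse P []       ι = refl
evalMonoℤ-inverse P (e ∷ es) ι = begin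
  powℤ P i e * m * (powℤ P i (ℤ.- e) * m⁻¹)   ≡⟨ *-interchange (powℤ P i e) m _ m⁻¹ ⟩
  powℤ P i e * powℤ P i (ℤ.- e) * (m * m⁻¹)   ≡⟨ cong₂ _*_ (powℤ-inverse P i e)
                                                    (evalMonoℤ-inverse P es (ι ∘ Fin.suc)) ⟩
  1ℚ                                          ∎
  where
  open ≡-Reasoning
  i   = ι Fin.zero
  m   = evalMonoℤ P (powℤ P) es (ι ∘ Fin.suc)
  m⁻¹ = evalMonoℤ P (powℤ P) (Vec.map ℤ.-_ es) (ι ∘ Fin.suc)

-- Polynomial growth

module Growth {S : Set} (X : S → ℚ) (1≤X : ∀ s → 1ℚ ≤ X s) where

  record PolyBounded (f : S → ℚ) : Set where
    constructor polyBounded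
    field
      coeff    : ℚ
      exponent : ℕ
      0≤coeff  : 0ℚ ≤ coeff
      bound    : ∀ s → ∣ f s ∣ ≤ coeff * X s ^ℚ exponent

  C*X^m≤C′*X^n : ∀ {C C′ m n} s → 0ℚ ≤ C → C ≤ C′ → m ℕ.≤ n → C * X s ^ℚ m ≤ C′ * X s ^ℚ n
  C*X^m≤C′*X^n {n = n} s 0≤C C≤C′ m≤n =
    *-mono-≤-nonNeg 0≤C (0≤p^n n (ℚP.≤-trans 0≤1 (1≤X s))) C≤C′ (^ℚ-monoʳ-≤ (1≤X s) m≤n)

  polyBounded-0 : PolyBounded (λ _ → 0ℚ)
  polyBounded-0 = polyBounded 0ℚ 0 ℚP.≤-refl (λ _ → ℚP.≤-reflexive (sym (ℚP.*-zeroˡ 1ℚ)))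

  polyBounded-scale : ∀ c {f} → PolyBounded f → PolyBounded (λ s → c * f s)
  polyBounded-scale c {f} (polyBounded C E 0≤C bf) =
    polyBounded (∣ c ∣ * C) E (0≤p*q (ℚP.0≤∣p∣ c) 0≤C) λ s → begin
      ∣ c * f s ∣              ≡⟨ ℚP.∣p*q∣≡∣p∣*∣q∣ c (f s) ⟩
      ∣ c ∣ * ∣ f s ∣          ≤⟨ ℚP.*-monoˡ-≤-nonNeg ∣ c ∣ {{ℚP.∣-∣-nonNeg c}} (bf s) ⟩
      ∣ c ∣ * (C * X s ^ℚ E)   ≡⟨ ℚP.*-assoc ∣ c ∣ C _ ⟨
      ∣ c ∣ * C * X s ^ℚ E     ∎
    where open ℚP.≤-Reasoning

  polyBounded-+ : ∀ {f g} → PolyBounded f → PolyBounded g → PolyBounded (λ s → f s + g s)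
  polyBounded-+ {f} {g} (polyBounded C E 0≤C bf) (polyBounded C′ E′ 0≤C′ bg) =
    polyBounded (C + C′) (E ℕ.+ E′) (ℚP.+-mono-≤ 0≤C 0≤C′) λ s → begin
      ∣ f s + g s ∣                          ≤⟨ ℚP.∣p+q∣≤∣p∣+∣q∣ (f s) (g s) ⟩
      ∣ f s ∣ + ∣ g s ∣                      ≤⟨ ℚP.+-mono-≤ (bf s) (bg s) ⟩
      C * X s ^ℚ E + C′ * X s ^ℚ E′          ≤⟨ ℚP.+-mono-≤
                                                  (C*X^m≤C′*X^n s 0≤C ℚP.≤-refl (ℕP.m≤m+n E E′))
                                                  (C*X^m≤C′*X^n s 0≤C′ ℚP.≤-refl (ℕP.m≤n+m E′ E)) ⟩
      C * X s ^ℚ F + C′ * X s ^ℚ F           ≡⟨ ℚP.*-distribʳ-+ (X s ^ℚ F) C C′ ⟨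
      (C + C′) * X s ^ℚ F                    ∎
    where
    open ℚP.≤-Reasoning
    F = E ℕ.+ E′

  uniformBound : ∀ {M} (f : Fin M → S → ℚ) → (∀ j → PolyBounded (f j)) →
    ∃ λ C → ∃ λ E → 0ℚ ≤ C × (∀ j s → ∣ f j s ∣ ≤ C * X s ^ℚ E)
  uniformBound {zero}  f bf = 0ℚ , 0 , ℚP.≤-refl , λ ()
  uniformBound {suc M} f bf with bf Fin.zero | uniformBound (f ∘ Fin.suc) (bf ∘ Fin.suc)
  ... | polyBounded C₀ E₀ 0≤C₀ b₀ | C , E , 0≤C , b =
    C₀ + C , E₀ ℕ.+ E , ℚP.+-mono-≤ 0≤C₀ 0≤C , λ where
      Fin.zero    s → ℚP.≤-trans (b₀ s) (C*X^m≤C′*X^n s 0≤C₀ (p≤p+q 0≤C) (ℕP.m≤m+n E₀ E))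
      (Fin.suc j) s → ℚP.≤-trans (b j s) (C*X^m≤C′*X^n s 0≤C (q≤p+q 0≤C₀) (ℕP.m≤n+m E E₀))

module _ {N M : ℕ} (φ : Morphism N M) where

  record ClearedPoint : Set where
    constructor clearedPoint
    field
      point   : TorusPoint N
      denom   : ℕ
      1≤denom : 1 ℕ.≤ denom
      clears  : ∀ j → Clears denom (apply φ point j)
  open ClearedPoint

  open Growth (λ s → fromℕ (denom s)) (λ s → fromℕ-mono-≤ (1≤denom s))

  monomial-polyBounded : IsClosedEmbedding φ → ∀ es →
    PolyBounded (λ s → evalMonoℤ (point s) (powℤ (point s)) es (λ i → i))
  monomial-polyBounded emb es with emb ((1ℚ , Vec.map ℤ.-_ es) ∷ [])
  ... | p , p∘φ≡x^-es = polyBounded (fromℕ D) e (0≤fromℕ D) λ s → begin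
    ∣ m s ∣                           ≤⟨ clears-inverse⇒∣p∣≤ {{K≢0 s}}
                                           (evalMonoℤ-inverse (point s) es (λ i → i)) (clears-m⁻¹ s) ⟩
    fromℕ (K s)                       ≡⟨ fromℕ-* D (denom s ℕ.^ e) ⟩
    fromℕ D * fromℕ (denom s ℕ.^ e)   ≡⟨ cong (fromℕ D *_) (fromℕ-^ (denom s) e) ⟩
    fromℕ D * fromℕ (denom s) ^ℚ e    ∎
    where
    open ℚP.≤-Reasoning
    D = coeffDenominator p
    e = degreeSum p
    K : ClearedPoint → ℕ
    K s = D ℕ.* denom s ℕ.^ e
    K≢0 : ∀ s → ℕ.NonZero (K s)
    K≢0 s = ℕP.m*n≢0 D _ {{coeffDenominator≢0 p}} {{ℕP.m^n≢0 (denom s) e {{ℕ.>-nonZero (1≤denom s)}}}}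
    m m⁻¹ : ClearedPoint → ℚ
    m   s = evalMonoℤ (point s) (powℤ (point s)) es (λ i → i)
    m⁻¹ s = evalMonoℤ (point s) (powℤ (point s)) (Vec.map ℤ.-_ es) (λ i → i)
    p∘φ≡m⁻¹ : ∀ s → evalPoly p (apply φ (point s)) ≡ m⁻¹ s
    p∘φ≡m⁻¹ s = trans (p∘φ≡x^-es (point s)) (trans (ℚP.+-identityʳ _) (ℚP.*-identityˡ (m⁻¹ s)))
    clears-m⁻¹ : ∀ s → Clears (K s) (m⁻¹ s)
    clears-m⁻¹ s = subst (Clears (K s)) (p∘φ≡m⁻¹ s) (clears-evalPoly p _ (clears s))

  laurent-polyBounded : IsClosedEmbedding φ → ∀ g → PolyBounded (λ s → evalLaurent g (point s))
  laurent-polyBounded emb []             = polyBounded-0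
  laurent-polyBounded emb ((c , es) ∷ g) =
    polyBounded-+ (polyBounded-scale c (monomial-polyBounded emb es)) (laurent-polyBounded emb g)

  coordinates-polyBounded : IsClosedEmbedding φ →
    ∃ λ C → ∃ λ E → 0ℚ ≤ C × (∀ j s → ∣ apply φ (point s) j ∣ ≤ C * fromℕ (denom s) ^ℚ E)
  coordinates-polyBounded emb = uniformBound _ (λ j → laurent-polyBounded emb (φ j))

-- p-adic valuations and prime parts

module Valuation (q : ℕ) .{{_ : ℕ.NonZero q}} where

  /-shrinks : ∀ {n f} → n ℕ.≤ f → suc n ℕ./ suc q ℕ.≤ f
  /-shrinks {n} n≤f = ℕP.≤-trans (ℕP.≤-pred (m/n<m (suc n) (suc q) (s≤s (ℕ.>-nonZero⁻¹ q)))) n≤f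

  valAux-0 : ∀ f → valAux q f 0 ≡ 0
  valAux-0 zero    = refl
  valAux-0 (suc f) = refl

  valAux-fuel : ∀ f g n → n ℕ.≤ f → n ℕ.≤ g → valAux q f n ≡ valAux q g n
  valAux-fuel f       g       zero    _         _         = trans (valAux-0 f) (sym (valAux-0 g))
  valAux-fuel (suc f) (suc g) (suc n) (s≤s n≤f) (s≤s n≤g) with suc q ∣? suc n
  ... | yes _ = cong suc (valAux-fuel f g (suc n ℕ./ suc q) (/-shrinks n≤f) (/-shrinks n≤g))
  ... | no  _ = refl

  val-∣ : ∀ n → suc q ∣ suc n → val q (suc n) ≡ suc (val q (suc n ℕ./ suc q))
  val-∣ n p∣n with suc q ∣? suc n
  ... | yes _   = cong suc (valAux-fuel n (suc n ℕ./ suc q) _ (/-shrinks ℕP.≤-refl) ℕP.≤-refl)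
  ... | no  p∤n = ⊥-elim (p∤n p∣n)

  val-∤ : ∀ n → ¬ (suc q ∣ n) → val q n ≡ 0
  val-∤ zero    _   = refl
  val-∤ (suc n) p∤n with suc q ∣? suc n
  ... | yes p∣n = ⊥-elim (p∤n p∣n)
  ... | no  _   = refl

  val-p* : ∀ m → val q (suc q ℕ.* suc m) ≡ suc (val q (suc m))
  val-p* m = begin
    val q (suc q ℕ.* suc m)                    ≡⟨ val-∣ (m ℕ.+ q ℕ.* suc m) (m∣m*n (suc m)) ⟩
    suc (val q (suc q ℕ.* suc m ℕ./ suc q))    ≡⟨ cong (λ n → suc (val q (n ℕ./ suc q)))
                                                     (ℕP.*-comm (suc q) (suc m)) ⟩
    suc (val q (suc m ℕ.* suc q ℕ./ suc q))    ≡⟨ cong (suc ∘ val q) (m*n/n≡m (suc m) (suc q)) ⟩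
    suc (val q (suc m))                        ∎
    where open ≡-Reasoning

  val-mono-* : ∀ k m → val q m ℕ.≤ val q (suc k ℕ.* m)
  val-mono-* k m = go m m ℕP.≤-refl
    where
    go : ∀ f m → m ℕ.≤ f → val q m ℕ.≤ val q (suc k ℕ.* m)
    go f       zero    _         = z≤n
    go (suc f) (suc m) (s≤s m≤f) = split (suc q ∣? suc m)
      where
      split : Dec (suc q ∣ suc m) → val q (suc m) ℕ.≤ val q (suc k ℕ.* suc m)
      split (no  p∤m) = subst (ℕ._≤ val q (suc k ℕ.* suc m)) (sym (val-∤ (suc m) p∤m)) z≤n
      split (yes p∣m) = begin
        val q (suc m)                                ≡⟨ val-∣ m p∣m ⟩
        suc (val q (suc m ℕ./ suc q))                ≤⟨ s≤s (go f (suc m ℕ./ suc q) (/-shrinks m≤f)) ⟩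
        suc (val q (suc k ℕ.* (suc m ℕ./ suc q)))    ≡⟨ cong (suc ∘ val q) (*-/-assoc (suc k) p∣m) ⟨
        suc (val q (suc k ℕ.* suc m ℕ./ suc q))      ≡⟨ val-∣ (m ℕ.+ k ℕ.* suc m) (∣n⇒∣m*n (suc k) p∣m) ⟨
        val q (suc k ℕ.* suc m)                      ∎
        where open ℕP.≤-Reasoning

-- As in `val` and `H-f`, the index q stands for the number q + 1.
primePart : ℕ → ℕ → ℕ
primePart q n = if does (prime? (suc q)) then suc q ℕ.^ val q n else 1

primeParts : List ℕ → ℕ → ℕ
primeParts qs n = product (map (λ q → primePart q n) qs)

1≤primePart : ∀ q n → 1 ℕ.≤ primePart q n
1≤primePart q n with prime? (suc q)
... | yes _ = ℕP.m^n>0 (suc q) (val q n)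
... | no  _ = ℕP.≤-refl

primePart-mono-* : ∀ q k m → primePart q m ℕ.≤ primePart q (suc k ℕ.* m)
primePart-mono-* q k m with prime? (suc q)
... | no  _ = ℕP.≤-refl
primePart-mono-* zero    k m | yes 1-prime = ⊥-elim (¬prime[1] 1-prime)
primePart-mono-* (suc r) k m | yes _       =
  ℕP.^-monoʳ-≤ (suc (suc r)) (Valuation.val-mono-* (suc r) k m)

primePart-p* : ∀ q m → Prime (suc q) → primePart q (suc q ℕ.* suc m) ≡ suc q ℕ.* primePart q (suc m)
primePart-p* q m p-prime with prime? (suc q)
... | no  p-composite = ⊥-elim (p-composite p-prime)
primePart-p* zero    m p-prime | yes _ = ⊥-elim (¬prime[1] p-prime)
primePart-p* (suc r) m p-prime | yes _ = cong (suc (suc r) ℕ.^_) (Valuation.val-p* (suc r) m)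

1≤primeParts : ∀ qs n → 1 ℕ.≤ primeParts qs n
1≤primeParts []       n = ℕP.≤-refl
1≤primeParts (q ∷ qs) n = ℕP.*-mono-≤ (1≤primePart q n) (1≤primeParts qs n)

primeParts-mono-* : ∀ qs k m → primeParts qs m ℕ.≤ primeParts qs (suc k ℕ.* m)
primeParts-mono-* []       k m = ℕP.≤-refl
primeParts-mono-* (q ∷ qs) k m = ℕP.*-mono-≤ (primePart-mono-* q k m) (primeParts-mono-* qs k m)

primeParts-p* : ∀ qs q m → Prime (suc q) → q ∈ qs →
  suc q ℕ.* primeParts qs (suc m) ℕ.≤ primeParts qs (suc q ℕ.* suc m)
primeParts-p* (q ∷ qs) q m p-prime (here refl) = begin
  suc q ℕ.* (primePart q (suc m) ℕ.* Π qs (suc m))    ≡⟨ ℕP.*-assoc (suc q) (primePart q (suc m)) _ ⟨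
  suc q ℕ.* primePart q (suc m) ℕ.* Π qs (suc m)      ≤⟨ ℕP.*-mono-≤
                                                          (ℕP.≤-reflexive (sym (primePart-p* q m p-prime)))
                                                          (primeParts-mono-* qs q (suc m)) ⟩
  primePart q (suc q ℕ.* suc m) ℕ.* Π qs (suc q ℕ.* suc m) ∎
  where
  open ℕP.≤-Reasoning
  Π = primeParts
primeParts-p* (q′ ∷ qs) q m p-prime (there q∈qs) = begin
  suc q ℕ.* (primePart q′ (suc m) ℕ.* Π qs (suc m))   ≡⟨ x∙yz≈y∙xz (suc q) (primePart q′ (suc m)) _ ⟩
  primePart q′ (suc m) ℕ.* (suc q ℕ.* Π qs (suc m))   ≤⟨ ℕP.*-mono-≤ (primePart-mono-* q′ q (suc m))
                                                          (primeParts-p* qs q m p-prime q∈qs) ⟩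
  primePart q′ (suc q ℕ.* suc m) ℕ.* Π qs (suc q ℕ.* suc m) ∎
  where
  open ℕP.≤-Reasoning
  Π = primeParts

p*-preserves-≤primeParts : ∀ B q n → Prime (suc q) → 1 ℕ.≤ n → suc q ℕ.* n ℕ.≤ B →
  n ℕ.≤ primeParts (upTo B) n → suc q ℕ.* n ℕ.≤ primeParts (upTo B) (suc q ℕ.* n)
p*-preserves-≤primeParts B q (suc m) p-prime _ p*n≤B n≤Π = begin
  suc q ℕ.* suc m                           ≤⟨ ℕP.*-monoʳ-≤ (suc q) n≤Π ⟩
  suc q ℕ.* primeParts (upTo B) (suc m)     ≤⟨ primeParts-p* (upTo B) q m p-prime q∈upToB ⟩
  primeParts (upTo B) (suc q ℕ.* suc m)     ∎
  where
  open ℕP.≤-Reasoning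
  q∈upToB : q ∈ upTo B
  q∈upToB = ∈-upTo⁺ (ℕP.≤-trans (ℕP.m≤m*n (suc q) (suc m)) p*n≤B)

primeProduct≤primeParts : ∀ B ps → All Prime ps → product ps ℕ.≤ B →
  product ps ℕ.≤ primeParts (upTo B) (product ps)
primeProduct≤primeParts B []           []                   _     = 1≤primeParts (upTo B) 1
primeProduct≤primeParts B (zero ∷ ps)  (0-prime ∷ _)        _     = ⊥-elim (¬prime[0] 0-prime)
primeProduct≤primeParts B (suc q ∷ ps) (p-prime ∷ ps-prime) p*n≤B =
  p*-preserves-≤primeParts B q (product ps) p-prime (productOfPrimes≥1 ps-prime) p*n≤B
    (primeProduct≤primeParts B ps ps-prime (ℕP.≤-trans (ℕP.m≤n*m (product ps) (suc q)) p*n≤B))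

n≤primeParts : ∀ B n .{{_ : ℕ.NonZero n}} → n ℕ.≤ B → n ℕ.≤ primeParts (upTo B) n
n≤primeParts B n n≤B = subst (λ n → n ℕ.≤ primeParts (upTo B) n) (sym n≡Πps)
  (primeProduct≤primeParts B ps ps-prime (subst (ℕ._≤ B) n≡Πps n≤B))
  where
  open PrimeFactorisation (factorise n)
    renaming (factors to ps; isFactorisation to n≡Πps; factorsPrime to ps-prime)

-- Denominators and the finite height

module _ (q : ℕ) .{{_ : ℕ.NonZero q}} where
  open Valuation q

  coprime⇒¬p∣both : ∀ {m n} → Coprime m n → suc q ∣ m → suc q ∣ n → ⊥
  coprime⇒¬p∣both m⊥n p∣m p∣n = ℕ.≢-nonZero⁻¹ q (ℕP.suc-injective (m⊥n (p∣m , p∣n)))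

  abs-p-p∣denominator : ∀ x → suc q ∣ ↧ₙ x → abs-p q x ≡ fromℕ (suc q ℕ.^ val q (↧ₙ x))
  abs-p-p∣denominator (mkℚ (+ zero) d c) p∣d =
    ⊥-elim (coprime⇒¬p∣both (recompute c) (suc q ∣0) p∣d)
  abs-p-p∣denominator (mkℚ (+ suc k) d c) p∣d
    rewrite val-∤ (suc k) (λ p∣n → coprime⇒¬p∣both (recompute c) p∣n p∣d) = z/1≡fromℤ _
  abs-p-p∣denominator (mkℚ -[1+ k ] d c) p∣d
    rewrite val-∤ (suc k) (λ p∣n → coprime⇒¬p∣both (recompute c) p∣n p∣d) = z/1≡fromℤ _

  p^val-denominator≤ : ∀ x {X} → 1ℚ ≤ X → abs-p q x ≤ X → fromℕ (suc q ℕ.^ val q (↧ₙ x)) ≤ X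
  p^val-denominator≤ x {X} 1≤X ∣x∣ₚ≤X = split (suc q ∣? ↧ₙ x)
    where
    split : Dec (suc q ∣ ↧ₙ x) → fromℕ (suc q ℕ.^ val q (↧ₙ x)) ≤ X
    split (yes p∣d) = subst (_≤ X) (abs-p-p∣denominator x p∣d) ∣x∣ₚ≤X
    split (no  p∤d) = subst (λ v → fromℕ (suc q ℕ.^ v) ≤ X) (sym (val-∤ (↧ₙ x) p∤d)) 1≤X

module _ {M : ℕ} (f : Fin M → ℚ) where

  private
    maxFrom : List (Fin M) → ℚ
    maxFrom = foldr (λ i acc → f i ℚ.⊔ acc) 1ℚ

  1≤maxOver : 1ℚ ≤ maxOver f
  1≤maxOver = go (allFin M)
    where
    go : ∀ is → 1ℚ ≤ maxFrom is
    go []       = ℚP.≤-refl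
    go (i ∷ is) = ℚP.p≤q⇒p≤r⊔q (f i) (go is)

  f≤maxOver : ∀ j → f j ≤ maxOver f
  f≤maxOver j = go (allFin M) (∈-allFin j)
    where
    go : ∀ is → j ∈ is → f j ≤ maxFrom is
    go (i ∷ is) (here refl)  = ℚP.p≤p⊔q (f j) (maxFrom is)
    go (i ∷ is) (there j∈is) = ℚP.p≤q⇒p≤r⊔q (f i) (go is j∈is)

  maxOver-lub : ∀ {X} → 1ℚ ≤ X → (∀ j → f j ≤ X) → maxOver f ≤ X
  maxOver-lub {X} 1≤X f≤X = go (allFin M)
    where
    go : ∀ is → maxFrom is ≤ X
    go []       = 1≤X
    go (i ∷ is) = ℚP.⊔-lub (f≤X i) (go is)

module _ {M : ℕ} (w : Fin M → ℚ) where

  1≤localFactor : ∀ q → 1ℚ ≤ localFactor q w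
  1≤localFactor q = 1≤maxOver (λ j → abs-p q (w j))

  p^val-denominator≤localFactor : ∀ q j → Prime (suc q) →
    fromℕ (suc q ℕ.^ val q (↧ₙ (w j))) ≤ localFactor q w
  p^val-denominator≤localFactor zero    j 1-prime = ⊥-elim (¬prime[1] 1-prime)
  p^val-denominator≤localFactor (suc r) j _       =
    p^val-denominator≤ (suc r) (w j) (1≤localFactor (suc r)) (f≤maxOver (λ j → abs-p (suc r) (w j)) j)

  localFactors : List ℕ → ℚ
  localFactors = foldr (λ q acc → (if does (prime? (suc q)) then localFactor q w else 1ℚ) * acc) 1ℚ

  1≤localFactors : ∀ qs → 1ℚ ≤ localFactors qs
  1≤localFactors []       = ℚP.≤-refl
  1≤localFactors (q ∷ qs) with prime? (suc q)
  ... | yes _ = 1≤p*q (1≤localFactor q) (1≤localFactors qs)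
  ... | no  _ = 1≤p*q ℚP.≤-refl (1≤localFactors qs)

  primeParts≤localFactors : ∀ n →
    (∀ q → Prime (suc q) → fromℕ (suc q ℕ.^ val q n) ≤ localFactor q w) →
    ∀ qs → fromℕ (primeParts qs n) ≤ localFactors qs
  primeParts≤localFactors n p^v≤ []       = ℚP.≤-refl
  primeParts≤localFactors n p^v≤ (q ∷ qs) =
    ℚP.≤-trans (ℚP.≤-reflexive (fromℕ-* (primePart q n) (primeParts qs n)))
      (*-mono-≤-nonNeg (0≤fromℕ _) (ℚP.≤-trans 0≤1 (1≤localFactors qs)) primePart≤factor
        (primeParts≤localFactors n p^v≤ qs))
    where
    primePart≤factor : fromℕ (primePart q n) ≤ (if does (prime? (suc q)) then localFactor q w else 1ℚ)
    primePart≤factor with prime? (suc q)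
    ... | yes p-prime = p^v≤ q p-prime
    ... | no  _       = ℚP.≤-refl

  1≤H-f : 1ℚ ≤ H-f w
  1≤H-f = 1≤localFactors (upTo (denomBound w))

  denominators : List (Fin M) → ℕ
  denominators = foldr (λ j acc → ↧ₙ (w j) ℕ.* acc) 1

  denominators≢0 : ∀ js → ℕ.NonZero (denominators js)
  denominators≢0 []       = _
  denominators≢0 (j ∷ js) = ℕP.m*n≢0 (↧ₙ (w j)) _ {{_}} {{denominators≢0 js}}

  ↧∣denominators : ∀ {js j} → j ∈ js → ↧ₙ (w j) ∣ denominators js
  ↧∣denominators {i ∷ js} (here refl)  = m∣m*n (denominators js)
  ↧∣denominators {i ∷ js} (there j∈js) = ∣n⇒∣m*n (↧ₙ (w i)) (↧∣denominators j∈js)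

  denomBound≢0 : ℕ.NonZero (denomBound w)
  denomBound≢0 = denominators≢0 (allFin M)

  ↧∣denomBound : ∀ j → ↧ₙ (w j) ∣ denomBound w
  ↧∣denomBound j = ↧∣denominators (∈-allFin j)

  denominator≤H-f : ∀ j → fromℕ (↧ₙ (w j)) ≤ H-f w
  denominator≤H-f j = ℚP.≤-trans
    (fromℕ-mono-≤ (n≤primeParts (denomBound w) d (∣⇒≤ {{denomBound≢0}} (↧∣denomBound j))))
    (primeParts≤localFactors d (λ q → p^val-denominator≤localFactor q j) (upTo (denomBound w)))
    where d = ↧ₙ (w j)

  denominators≤H-f^length : ∀ js → fromℕ (denominators js) ≤ H-f w ^ℚ length js
  denominators≤H-f^length []       = ℚP.≤-refl
  denominators≤H-f^length (j ∷ js) =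
    ℚP.≤-trans (ℚP.≤-reflexive (fromℕ-* (↧ₙ (w j)) (denominators js)))
      (*-mono-≤-nonNeg (0≤fromℕ _) (0≤p^n (length js) (ℚP.≤-trans 0≤1 1≤H-f))
        (denominator≤H-f j) (denominators≤H-f^length js))

  denomBound≤H-f^M : fromℕ (denomBound w) ≤ H-f w ^ℚ M
  denomBound≤H-f^M = subst (λ n → fromℕ (denomBound w) ≤ H-f w ^ℚ n) (length-tabulate {n = M} (λ j → j))
    (denominators≤H-f^length (allFin M))

H-R≤1+ : ∀ {M} (w : Fin M → ℚ) {X} → 0ℚ ≤ X → (∀ j → ∣ w j ∣ ≤ X) → H-R w ≤ 1ℚ + X
H-R≤1+ w 0≤X ∣w∣≤X = maxOver-lub (λ j → ∣ w j ∣) (p≤p+q 0≤X) (λ j → ℚP.≤-trans (∣w∣≤X j) (q≤p+q 0≤1))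

clearedImage : ∀ {N M} (φ : Morphism N M) → TorusPoint N → ClearedPoint φ
clearedImage φ P = clearedPoint P (denomBound w) (ℕ.>-nonZero⁻¹ _ {{denomBound≢0 w}})
  (λ j → clears-∣ (↧∣denomBound w j) (clears-↧ (w j)))
  where w = apply φ P

mainTheorem20 : (N M : ℕ) (φ : Morphism N M) → IsClosedEmbedding φ →
    ∃ λ (a : ℚ) → ∃ λ (b : ℕ) → ∃ λ (c : ℚ) →
    (0ℚ ≤ a) × (0ℚ ≤ c) ×
    (∀ (P : TorusPoint N) →
    H-R (apply φ P) ≤ c + a * (H-f (apply φ P) ^ℚ b))
mainTheorem20 N M φ emb with coordinates-polyBounded φ emb
... | C , E , 0≤C , bound = C , M ℕ.* E , 1ℚ , 0≤C , 0≤1 , λ P →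
  let w = apply φ P in
  H-R≤1+ w (0≤p*q 0≤C (0≤p^n (M ℕ.* E) (ℚP.≤-trans 0≤1 (1≤H-f w)))) λ j → begin
    ∣ w j ∣                           ≤⟨ bound j (clearedImage φ P) ⟩
    C * fromℕ (denomBound w) ^ℚ E     ≤⟨ ℚP.*-monoˡ-≤-nonNeg C {{ℚ.nonNegative 0≤C}}
                                           (^ℚ-monoˡ-≤ E (0≤fromℕ _) (denomBound≤H-f^M w)) ⟩
    C * (H-f w ^ℚ M) ^ℚ E             ≡⟨ cong (C *_) (^ℚ-* (H-f w) M E) ⟨
    C * H-f w ^ℚ (M ℕ.* E)            ∎
  where open ℚP.≤-Reasoning
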